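{- The $(a,b)$ matching game is a win for Maker if one of the following holds: (i) $b\ge 4$; (ii) $a\in\{2,3\}$ and $b\ge 3$; (iii) $a=1$ and $b\ge 2$.
   Context: For positive integers $a,b$, let $G_{a,b}$ be the graph on a vertex set partitioned into $A$ and $B$ with $|A|=a$, $|B|=b$, whose edges are all pairs of vertices except pairs with both ends in $B$. The $(a,b)$ matching game is the Maker-Breaker game on the edges of $G_{a,b}$ (Breaker and Maker alternately claim unclaimed edges, Breaker first, until all edges are claimed), in which Maker wins iff his claimed edges contain a matching saturating every vertex of $A$. -}

module Defs where

open import Data.Nat using (ℕ)
open import Data.Fin using (Fin; _<_)
open import Data.Sum using (_⊎_; inj₁; inj₂)
open import Data.Product using (∃; _×_)
open import Data.List using (List; []; _∷_)
open import Data.List.Membership.Propositional using (_∈_)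
open import Data.List.Relation.Unary.All using (All)
open import Data.List.Relation.Unary.Any using (Any)
open import Data.List.Relation.Unary.AllPairs using (AllPairs)
open import Data.Empty using (⊥)
open import Relation.Nullary using (¬_)
open import Relation.Binary.PropositionalEquality using (_≡_)

-- Vertices of G_{a,b}: inj₁ i ∈ A (|A| = a), inj₂ j ∈ B (|B| = b).
Vertex : ℕ → ℕ → Set
Vertex a b = Fin a ⊎ Fin b

-- Edges of G_{a,b}: every pair except pairs inside B.
-- An A–A edge {i,j} is represented once, with i < j; an A–B edge by its two ends.
data Edge (a b : ℕ) : Set where
  aa : (i j : Fin a) → i < j → Edge a b
  ab : (i : Fin a) → (j : Fin b) → Edge a b

data Incident {a b : ℕ} : Vertex a b → Edge a b → Set where
  aa-left  : ∀ {i j} (p : i < j) → Incident (inj₁ i) (aa i j p)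
  aa-right : ∀ {i j} (p : i < j) → Incident (inj₁ j) (aa i j p)
  ab-left  : ∀ {i j} → Incident (inj₁ i) (ab i j)
  ab-right : ∀ {i j} → Incident (inj₂ j) (ab i j)

VertexDisjoint : ∀ {a b} → Edge a b → Edge a b → Set
VertexDisjoint {a} {b} e f = (v : Vertex a b) → Incident v e → Incident v f → ⊥

HasASaturatingMatching : ∀ {a b} → List (Edge a b) → Set
HasASaturatingMatching {a} {b} M =
  ∃ λ (ms : List (Edge a b)) →
    All (_∈ M) ms
    × AllPairs VertexDisjoint ms
    × ((i : Fin a) → Any (Incident (inj₁ i)) ms)

Claimed : ∀ {a b} → List (Edge a b) → List (Edge a b) → Edge a b → Set
Claimed M Br e = e ∈ M ⊎ e ∈ Br

AllClaimed : ∀ {a b} → List (Edge a b) → List (Edge a b) → Set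
AllClaimed M Br = ∀ e → Claimed M Br e

-- The game ends when all edges are claimed; Maker wins iff his edges contain
-- a matching saturating A.  (Inductive = Maker has a winning strategy.)
data WinBreakerToMove {a b : ℕ} (M Br : List (Edge a b)) : Set
data WinMakerToMove {a b : ℕ} (M Br : List (Edge a b)) : Set

data WinBreakerToMove {a} {b} M Br where
  game-over : AllClaimed M Br → HasASaturatingMatching M → WinBreakerToMove M Br
  breaker-moves : (∃ λ e → ¬ Claimed M Br e) →
                  (∀ e → ¬ Claimed M Br e → WinMakerToMove M (e ∷ Br)) →
                  WinBreakerToMove M Br

data WinMakerToMove {a} {b} M Br where
  game-over : AllClaimed M Br → HasASaturatingMatching M → WinMakerToMove M Br
  maker-moves : (e : Edge a b) → ¬ Claimed M Br e →
                WinBreakerToMove (e ∷ M) Br → WinMakerToMove M Br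

MakerWins : ℕ → ℕ → Set
MakerWins a b = WinBreakerToMove {a} {b} [] []

-- Maker plays a pairing strategy.  A winning pairing is a family of disjoint pairs of
-- edges such that every edge set meeting each pair contains a matching saturating A;
-- answering every Breaker edge by its partner, Maker meets each pair by the end.
-- Winning pairings of G_{1,2}, G_{2,3}, G_{3,3}, G_{4,4}, G_{5,4} and G_{6,0} are given
-- explicitly and verified by exhaustive case trees.  Pairings of vertex-disjoint
-- subgraphs combine and extra B-vertices may be ignored, so writing a = 6k + r with
-- r ≤ 5 gives a winning pairing of G_{a,b} for every b ≥ 4.
module Submission where

open import Defs
open import Data.Nat as ℕ using (ℕ; suc; _+_; _≤_; z≤n; s≤s)
import Data.Nat.Properties as ℕ
open import Data.Fin as Fin using (Fin; _<_; toℕ; _↑ˡ_; _↑ʳ_; splitAt; inject≤; #_)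
import Data.Fin.Properties as Fin
open import Data.Sum as Sum using (_⊎_; inj₁; inj₂)
import Data.Sum.Properties as Sum
open import Data.Product as Product using (∃; _×_; _,_; proj₁; proj₂; swap)
import Data.Product.Properties as Product
open import Data.List using (List; []; _∷_; _++_; map; concat; length; filter; cartesianProductWith; allFin)
open import Data.List.Membership.Propositional using (_∈_; find; lose)
open import Data.List.Membership.Propositional.Properties
  using (∈-concat⁺′; ∈-++⁺ˡ; ∈-++⁺ʳ; ∈-cartesianProductWith⁺; ∈-allFin)
import Data.List.Membership.DecPropositional as DecMembership
open import Data.List.Relation.Unary.Any as Any using (Any; here; there; any?)
import Data.List.Relation.Unary.Any.Properties as Any
open import Data.List.Relation.Unary.All as All using (All; []; _∷_; all?)
import Data.List.Relation.Unary.All.Properties as All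
open import Data.List.Relation.Unary.AllPairs as AllPairs using (AllPairs)
import Data.List.Relation.Unary.AllPairs.Properties as AllPairs
open import Data.Empty using (⊥-elim)
open import Function using (_∘_)
open import Relation.Nullary using (¬_; Dec; yes; no; ¬?)
open import Relation.Nullary.Decidable using (_⊎-dec_; _×-dec_; _→-dec_; map′; True; toWitness; decidable-stable)
open import Relation.Unary using (Pred; Decidable; _⊆_)
open import Relation.Binary.Definitions using (DecidableEquality; tri<; tri≈; tri>)
open import Relation.Binary.PropositionalEquality using (_≡_; _≢_; refl; cong; sym; trans; subst₂)

_≟ᴱ_ : ∀ {a b} → DecidableEquality (Edge a b)
aa i j p ≟ᴱ aa i′ j′ p′ with i Fin.≟ i′ | j Fin.≟ j′
... | yes refl | yes refl = yes (cong (aa i j) (Fin.<-irrelevant p p′))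
... | no i≢i′  | _        = no λ { refl → i≢i′ refl }
... | yes _    | no j≢j′  = no λ { refl → j≢j′ refl }
aa _ _ _ ≟ᴱ ab _ _ = no λ ()
ab _ _ ≟ᴱ aa _ _ _ = no λ ()
ab i j ≟ᴱ ab i′ j′ with i Fin.≟ i′ | j Fin.≟ j′
... | yes refl | yes refl = yes refl
... | no i≢i′  | _        = no λ { refl → i≢i′ refl }
... | yes _    | no j≢j′  = no λ { refl → j≢j′ refl }

aaEdges : ∀ {a b} → Fin a → Fin a → List (Edge a b)
aaEdges i j with i Fin.<? j
... | yes i<j = aa i j i<j ∷ []
... | no _    = []

∈-aaEdges : ∀ {a b} {i j : Fin a} (i<j : i < j) → aa {b = b} i j i<j ∈ aaEdges i j
∈-aaEdges {i = i} {j} i<j with i Fin.<? j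
... | yes i<j′ = here (cong (aa i j) (Fin.<-irrelevant i<j i<j′))
... | no i≮j   = ⊥-elim (i≮j i<j)

allEdges : ∀ a b → List (Edge a b)
allEdges a b = concat (cartesianProductWith aaEdges (allFin a) (allFin a))
            ++ cartesianProductWith ab (allFin a) (allFin b)

∈-allEdges : ∀ {a b} (e : Edge a b) → e ∈ allEdges a b
∈-allEdges (aa i j i<j) =
  ∈-++⁺ˡ (∈-concat⁺′ (∈-aaEdges i<j) (∈-cartesianProductWith⁺ aaEdges (∈-allFin i) (∈-allFin j)))
∈-allEdges {a} (ab i j) =
  ∈-++⁺ʳ (concat (cartesianProductWith aaEdges (allFin a) (allFin a)))
         (∈-cartesianProductWith⁺ ab (∈-allFin i) (∈-allFin j))

module _ {a p q} {A : Set a} {P : Pred A p} {Q : Pred A q}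
         (P? : Decidable P) (Q? : Decidable Q) (Q⊆P : Q ⊆ P) where

  length-filter-mono : ∀ xs → length (filter Q? xs) ≤ length (filter P? xs)
  length-filter-mono [] = z≤n
  length-filter-mono (x ∷ xs) with P? x | Q? x
  ... | yes _ | yes _ = s≤s (length-filter-mono xs)
  ... | yes _ | no _  = ℕ.m≤n⇒m≤1+n (length-filter-mono xs)
  ... | no ¬Px | yes Qx = ⊥-elim (¬Px (Q⊆P Qx))
  ... | no _  | no _  = length-filter-mono xs

  length-filter-strict : ∀ {x xs} → x ∈ xs → P x → ¬ Q x →
                         length (filter Q? xs) ℕ.< length (filter P? xs)
  length-filter-strict {xs = y ∷ xs} x∈ Px ¬Qx with P? y | Q? y | x∈
  ... | no ¬Py | yes Qy | _ = ⊥-elim (¬Py (Q⊆P Qy))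
  ... | yes _ | yes Qy | here refl = ⊥-elim (¬Qx Qy)
  ... | yes _ | yes _ | there x∈xs = s≤s (length-filter-strict x∈xs Px ¬Qx)
  ... | yes _ | no _  | _ = s≤s (length-filter-mono xs)
  ... | no ¬Py | no _ | here refl = ⊥-elim (¬Py Px)
  ... | no _  | no _  | there x∈xs = length-filter-strict x∈xs Px ¬Qx

all²-map : ∀ {X Y Z : Set} {R : Z → Z → Set} {f : X → Z} {g : Y → Z} →
           (∀ x y → R (f x) (g y)) → ∀ xs ys → All (λ z → All (R z) (map g ys)) (map f xs)
all²-map R-fg xs ys = All.map⁺ (All.tabulate λ {x} _ → All.map⁺ (All.tabulate λ {y} _ → R-fg x y))

all²-++ : ∀ {Z : Set} {R : Z → Z → Set} {xs ys} →
          All (λ z → All (R z) xs) xs → All (λ z → All (R z) ys) xs →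
          All (λ z → All (R z) xs) ys → All (λ z → All (R z) ys) ys →
          All (λ z → All (R z) (xs ++ ys)) (xs ++ ys)
all²-++ xx xy yx yy =
  All.++⁺ (All.zipWith (Product.uncurry All.++⁺) (xx , xy))
          (All.zipWith (Product.uncurry All.++⁺) (yx , yy))

EdgePair : ℕ → ℕ → Set
EdgePair a b = Edge a b × Edge a b

_∈ₚ_ : ∀ {a b} → Edge a b → EdgePair a b → Set
x ∈ₚ p = x ≡ proj₁ p ⊎ x ≡ proj₂ p

_∈ₚ?_ : ∀ {a b} (x : Edge a b) (p : EdgePair a b) → Dec (x ∈ₚ p)
x ∈ₚ? p = x ≟ᴱ proj₁ p ⊎-dec x ≟ᴱ proj₂ p

Separated : ∀ {a b} → EdgePair a b → EdgePair a b → Set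
Separated p q = (proj₁ p ∈ₚ q ⊎ proj₂ p ∈ₚ q) → p ≡ q ⊎ p ≡ swap q

separated-⊆ : ∀ {a b} {p q : EdgePair a b} {e f} →
              Separated p q → e ∈ₚ p → e ∈ₚ q → f ∈ₚ p → f ∈ₚ q
separated-⊆ sep e∈p e∈q f∈p
  with sep (Sum.map (λ { refl → e∈q }) (λ { refl → e∈q }) e∈p)
... | inj₁ refl = f∈p
... | inj₂ refl = Sum.swap f∈p

edge-disjoint⇒separated : ∀ {a b} {p q : EdgePair a b} →
                          (∀ {x} → x ∈ₚ p → ¬ x ∈ₚ q) → Separated p q
edge-disjoint⇒separated disj (inj₁ p₁∈q) = ⊥-elim (disj (inj₁ refl) p₁∈q)
edge-disjoint⇒separated disj (inj₂ p₂∈q) = ⊥-elim (disj (inj₂ refl) p₂∈q)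

record IsPairing {a b} (P : List (EdgePair a b)) : Set where
  field
    distinct  : All (λ p → proj₁ p ≢ proj₂ p) P
    separated : All (λ p → All (Separated p) P) P

SaturatingMatchingIn : ∀ {a b} → (Edge a b → Set) → Set
SaturatingMatchingIn {a} {b} S = ∃ λ (ms : List (Edge a b)) →
  All S ms × AllPairs VertexDisjoint ms × ((i : Fin a) → Any (Incident (inj₁ i)) ms)

Meets : ∀ {a b} → (Edge a b → Set) → List (EdgePair a b) → Set
Meets S P = All (λ p → S (proj₁ p) ⊎ S (proj₂ p)) P

record WinningPairing (a b : ℕ) : Set₁ where
  field
    pairs     : List (EdgePair a b)
    isPairing : IsPairing pairs
    forcing   : ∀ S → Meets S pairs → SaturatingMatchingIn S

module PairingStrategy {a b : ℕ} (W : WinningPairing a b) where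
  open WinningPairing W
  open IsPairing isPairing
  open DecMembership (_≟ᴱ_ {a} {b}) using (_∈?_)

  Unclaimed : List (Edge a b) → List (Edge a b) → Edge a b → Set
  Unclaimed M Br e = ¬ Claimed M Br e

  claimed? : ∀ M Br → Decidable (Claimed M Br)
  claimed? M Br e = e ∈? M ⊎-dec e ∈? Br

  unclaimed-maker : ∀ {M Br m x} → Unclaimed M Br x → x ≢ m → Unclaimed (m ∷ M) Br x
  unclaimed-maker u x≢m (inj₁ (here x≡m)) = x≢m x≡m
  unclaimed-maker u x≢m (inj₁ (there x∈M)) = u (inj₁ x∈M)
  unclaimed-maker u x≢m (inj₂ x∈Br) = u (inj₂ x∈Br)

  unclaimed-breaker : ∀ {M Br e x} → Unclaimed M Br x → x ≢ e → Unclaimed M (e ∷ Br) x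
  unclaimed-breaker u x≢e (inj₁ x∈M) = u (inj₁ x∈M)
  unclaimed-breaker u x≢e (inj₂ (here x≡e)) = x≢e x≡e
  unclaimed-breaker u x≢e (inj₂ (there x∈Br)) = u (inj₂ x∈Br)

  unclaimedCount : List (Edge a b) → List (Edge a b) → ℕ
  unclaimedCount M Br = length (filter (¬? ∘ claimed? M Br) (allEdges a b))

  unclaimedCount-maker : ∀ {M Br m} → Unclaimed M Br m →
                         unclaimedCount (m ∷ M) Br ℕ.< unclaimedCount M Br
  unclaimedCount-maker {M} {Br} {m} u =
    length-filter-strict (¬? ∘ claimed? M Br) (¬? ∘ claimed? (m ∷ M) Br)
      (λ u′ c → u′ (Sum.map₁ there c)) (∈-allEdges m) u (λ u′ → u′ (inj₁ (here refl)))

  unclaimedCount-breaker : ∀ {M Br e} → Unclaimed M Br e →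
                           unclaimedCount M (e ∷ Br) ℕ.< unclaimedCount M Br
  unclaimedCount-breaker {M} {Br} {e} u =
    length-filter-strict (¬? ∘ claimed? M Br) (¬? ∘ claimed? M (e ∷ Br))
      (λ u′ c → u′ (Sum.map₂ there c)) (∈-allEdges e) u (λ u′ → u′ (inj₂ (here refl)))

  unclaimed-or-allClaimed : ∀ M Br → (∃ λ e → Unclaimed M Br e) ⊎ AllClaimed M Br
  unclaimed-or-allClaimed M Br with any? (¬? ∘ claimed? M Br) (allEdges a b)
  ... | yes some = inj₁ (let (e , _ , u) = find some in e , u)
  ... | no none = inj₂ λ e → decidable-stable (claimed? M Br e)
                              (none ∘ lose (∈-allEdges e))

  Intact : List (Edge a b) → List (Edge a b) → EdgePair a b → Set
  Intact M Br p = Unclaimed M Br (proj₁ p) × Unclaimed M Br (proj₂ p)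

  intact? : ∀ M Br → Decidable (Intact M Br)
  intact? M Br p = ¬? (claimed? M Br (proj₁ p)) ×-dec ¬? (claimed? M Br (proj₂ p))

  intact⇒unclaimed : ∀ {M Br p x} → Intact M Br p → x ∈ₚ p → Unclaimed M Br x
  intact⇒unclaimed (u₁ , _) (inj₁ refl) = u₁
  intact⇒unclaimed (_ , u₂) (inj₂ refl) = u₂

  Safe : List (Edge a b) → List (Edge a b) → EdgePair a b → Set
  Safe M Br p = (proj₁ p ∈ M ⊎ proj₂ p ∈ M) ⊎ Intact M Br p

  safe-maker : ∀ {M Br m p} → Safe M Br p → Safe (m ∷ M) Br p
  safe-maker (inj₁ owned) = inj₁ (Sum.map there there owned)
  safe-maker {m = m} {p = p} (inj₂ (u₁ , u₂)) with proj₁ p ≟ᴱ m | proj₂ p ≟ᴱ m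
  ... | yes p₁≡m | _        = inj₁ (inj₁ (here p₁≡m))
  ... | no _     | yes p₂≡m = inj₁ (inj₂ (here p₂≡m))
  ... | no p₁≢m  | no p₂≢m  = inj₂ (unclaimed-maker u₁ p₁≢m , unclaimed-maker u₂ p₂≢m)

  safe-breaker : ∀ {M Br e p} → Safe M Br p → (Intact M Br p → ¬ e ∈ₚ p) → Safe M (e ∷ Br) p
  safe-breaker (inj₁ owned) _ = inj₁ owned
  safe-breaker (inj₂ (u₁ , u₂)) e∉p = inj₂
    ( unclaimed-breaker u₁ (λ { refl → e∉p (u₁ , u₂) (inj₁ refl) })
    , unclaimed-breaker u₂ (λ { refl → e∉p (u₁ , u₂) (inj₂ refl) }) )

  safe-allClaimed : ∀ {M Br} → AllClaimed M Br → All (Safe M Br) pairs → Meets (_∈ M) pairs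
  safe-allClaimed all-claimed = All.map λ where
    (inj₁ owned)  → owned
    (inj₂ (u , _)) → ⊥-elim (u (all-claimed _))

  partner : ∀ {M Br e p} → p ∈ pairs → Intact M Br p → e ∈ₚ p →
            ∃ λ f → f ∈ₚ p × Unclaimed M (e ∷ Br) f
  partner p∈ (_ , u₂) (inj₁ refl) =
    _ , inj₂ refl , unclaimed-breaker u₂ (All.lookup distinct p∈ ∘ sym)
  partner p∈ (u₁ , _) (inj₂ refl) =
    _ , inj₁ refl , unclaimed-breaker u₁ (All.lookup distinct p∈)

  safe-answer : ∀ {M Br e f p q} → p ∈ pairs → e ∈ₚ p → f ∈ₚ p → q ∈ pairs →
                Safe M Br q → Safe (f ∷ M) (e ∷ Br) q
  safe-answer p∈ e∈p f∈p q∈ safe = safe-breaker (safe-maker safe) λ intact e∈q →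
    intact⇒unclaimed intact (separated-⊆ (All.lookup (All.lookup separated p∈) q∈) e∈p e∈q f∈p)
                     (inj₁ (here refl))

  winFrom : ∀ n M Br → unclaimedCount M Br ≤ n → All (Safe M Br) pairs →
            WinBreakerToMove M Br
  answer : ∀ n M Br → All (Safe M Br) pairs → ∀ e → Unclaimed M Br e →
           unclaimedCount M (e ∷ Br) ℕ.< n → WinMakerToMove M (e ∷ Br)
  playAny : ∀ n M Br → unclaimedCount M Br ≤ n → All (Safe M Br) pairs →
            WinMakerToMove M Br

  winFrom n M Br count≤n safe with unclaimed-or-allClaimed M Br
  ... | inj₁ free = breaker-moves free λ e u →
          answer n M Br safe e u (ℕ.<-≤-trans (unclaimedCount-breaker u) count≤n)
  ... | inj₂ all-claimed = game-over all-claimed (forcing _ (safe-allClaimed all-claimed safe))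

  answer (suc n) M Br safe e u count<n with any? (λ p → e ∈ₚ? p ×-dec intact? M Br p) pairs
  ... | no miss = playAny n M (e ∷ Br) (ℕ.≤-pred count<n)
          (All.tabulate λ p∈ → safe-breaker (All.lookup safe p∈) λ intact e∈p → miss (lose p∈ (e∈p , intact)))
  ... | yes hit with find hit
  ...   | p , p∈ , e∈p , intact with partner p∈ intact e∈p
  ...     | f , f∈p , f-free = maker-moves f f-free
            (winFrom n (f ∷ M) (e ∷ Br) (ℕ.≤-pred (ℕ.<-trans (unclaimedCount-maker f-free) count<n))
                     (All.tabulate λ q∈ → safe-answer p∈ e∈p f∈p q∈ (All.lookup safe q∈)))

  playAny n M Br count≤n safe with unclaimed-or-allClaimed M Br
  ... | inj₁ (m , m-free) = maker-moves m m-free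
          (winFrom n (m ∷ M) Br (ℕ.<⇒≤ (ℕ.<-≤-trans (unclaimedCount-maker m-free) count≤n))
                   (All.map safe-maker safe))
  ... | inj₂ all-claimed = game-over all-claimed (forcing _ (safe-allClaimed all-claimed safe))

  makerWins : MakerWins a b
  makerWins = winFrom _ [] [] ℕ.≤-refl (All.tabulate λ _ → inj₂ (nothing-claimed , nothing-claimed))
    where
    nothing-claimed : ∀ {e} → Unclaimed [] [] e
    nothing-claimed (inj₁ ())
    nothing-claimed (inj₂ ())

pairingStrategy : ∀ {a b} → WinningPairing a b → MakerWins a b
pairingStrategy W = PairingStrategy.makerWins W

aa-injective : ∀ {a b} {i j i′ j′ : Fin a} {i<j i′<j′} →
               aa {b = b} i j i<j ≡ aa i′ j′ i′<j′ → i ≡ i′ × j ≡ j′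
aa-injective refl = refl , refl

ab-injective : ∀ {a b} {i i′ : Fin a} {j j′ : Fin b} → ab i j ≡ ab i′ j′ → i ≡ i′ × j ≡ j′
ab-injective refl = refl , refl

-- onA must be monotone because an A–A edge is stored with its ends in increasing order.
record Embedding (a′ b′ a b : ℕ) : Set where
  field
    onA           : Fin a′ → Fin a
    onA-mono      : ∀ {i j} → i < j → onA i < onA j
    onB           : Fin b′ → Fin b
    onB-injective : ∀ {i j} → onB i ≡ onB j → i ≡ j

  onA-injective : ∀ {i j} → onA i ≡ onA j → i ≡ j
  onA-injective {i} {j} eq with Fin.<-cmp i j
  ... | tri< i<j _ _ = ⊥-elim (Fin.<-irrefl eq (onA-mono i<j))
  ... | tri≈ _ i≡j _ = i≡j
  ... | tri> _ _ j<i = ⊥-elim (Fin.<-irrefl (sym eq) (onA-mono j<i))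

  vertex : Vertex a′ b′ → Vertex a b
  vertex = Sum.map onA onB

  edge : Edge a′ b′ → Edge a b
  edge (aa i j i<j) = aa (onA i) (onA j) (onA-mono i<j)
  edge (ab i j)     = ab (onA i) (onB j)

  edgePair : EdgePair a′ b′ → EdgePair a b
  edgePair = Product.map edge edge

  vertex-injective : ∀ {v w} → vertex v ≡ vertex w → v ≡ w
  vertex-injective {inj₁ _} {inj₁ _} eq = cong inj₁ (onA-injective (Sum.inj₁-injective eq))
  vertex-injective {inj₂ _} {inj₂ _} eq = cong inj₂ (onB-injective (Sum.inj₂-injective eq))

  edge-injective : ∀ {e f} → edge e ≡ edge f → e ≡ f
  edge-injective {aa i j i<j} {aa _ _ i′<j′} eq
    with refl ← onA-injective (proj₁ (aa-injective eq))
       | refl ← onA-injective (proj₂ (aa-injective eq))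
    = cong (aa i j) (Fin.<-irrelevant i<j i′<j′)
  edge-injective {ab _ _} {ab _ _} eq
    with refl ← onA-injective (proj₁ (ab-injective eq))
       | refl ← onB-injective (proj₂ (ab-injective eq))
    = refl

  incident-edge : ∀ {v e} → Incident v e → Incident (vertex v) (edge e)
  incident-edge (aa-left _)  = aa-left _
  incident-edge (aa-right _) = aa-right _
  incident-edge ab-left      = ab-left
  incident-edge ab-right     = ab-right

  incident-edge⁻ : ∀ {w e} → Incident w (edge e) → ∃ λ v → w ≡ vertex v × Incident v e
  incident-edge⁻ {e = aa i _ i<j} (aa-left _)  = inj₁ i , refl , aa-left i<j
  incident-edge⁻ {e = aa _ j i<j} (aa-right _) = inj₁ j , refl , aa-right i<j
  incident-edge⁻ {e = ab i _}     ab-left      = inj₁ i , refl , ab-left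
  incident-edge⁻ {e = ab _ j}     ab-right     = inj₂ j , refl , ab-right

  disjoint-edge : ∀ {e f} → VertexDisjoint e f → VertexDisjoint (edge e) (edge f)
  disjoint-edge {e} {f} disj w w∈e w∈f
    with v , refl , v∈e ← incident-edge⁻ {e = e} w∈e
       | v′ , v≡v′ , v′∈f ← incident-edge⁻ {e = f} w∈f
    with refl ← vertex-injective {v} {v′} v≡v′
    = disj v v∈e v′∈f

  separated-edgePair : ∀ {p q} → Separated p q → Separated (edgePair p) (edgePair q)
  separated-edgePair sep shared
    with sep (Sum.map (Sum.map edge-injective edge-injective) (Sum.map edge-injective edge-injective) shared)
  ... | inj₁ refl = inj₁ refl
  ... | inj₂ refl = inj₂ refl

open Embedding using (onA; onB)

module Combine {a₁ b₁ a₂ b₂ a b : ℕ} (E₁ : Embedding a₁ b₁ a b) (E₂ : Embedding a₂ b₂ a b)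
  (disjointA : ∀ i j → onA E₁ i ≢ onA E₂ j)
  (disjointB : ∀ i j → onB E₁ i ≢ onB E₂ j)
  (coverA : ∀ k → (∃ λ i → onA E₁ i ≡ k) ⊎ (∃ λ j → onA E₂ j ≡ k))
  where
  module E₁ = Embedding E₁
  module E₂ = Embedding E₂

  vertex-disjoint : ∀ v w → E₁.vertex v ≢ E₂.vertex w
  vertex-disjoint (inj₁ i) (inj₁ j) eq = disjointA i j (Sum.inj₁-injective eq)
  vertex-disjoint (inj₂ i) (inj₂ j) eq = disjointB i j (Sum.inj₂-injective eq)

  edge-disjoint : ∀ e f → E₁.edge e ≢ E₂.edge f
  edge-disjoint (aa i _ _) (aa j _ _) eq = disjointA i j (proj₁ (aa-injective eq))
  edge-disjoint (ab i _)   (ab j _)   eq = disjointA i j (proj₁ (ab-injective eq))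

  edges-vertexDisjoint : ∀ e f → VertexDisjoint (E₁.edge e) (E₂.edge f)
  edges-vertexDisjoint e f w w∈e w∈f
    with v , refl , _ ← E₁.incident-edge⁻ {e = e} w∈e
       | v′ , v≡v′ , _ ← E₂.incident-edge⁻ {e = f} w∈f
    = vertex-disjoint v v′ v≡v′

  pairs-edgeDisjoint : ∀ p q {x} → x ∈ₚ E₁.edgePair p → ¬ x ∈ₚ E₂.edgePair q
  pairs-edgeDisjoint _ _ (inj₁ refl) (inj₁ eq) = edge-disjoint _ _ eq
  pairs-edgeDisjoint _ _ (inj₁ refl) (inj₂ eq) = edge-disjoint _ _ eq
  pairs-edgeDisjoint _ _ (inj₂ refl) (inj₁ eq) = edge-disjoint _ _ eq
  pairs-edgeDisjoint _ _ (inj₂ refl) (inj₂ eq) = edge-disjoint _ _ eq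

  combine : WinningPairing a₁ b₁ → WinningPairing a₂ b₂ → WinningPairing a b
  combine W₁ W₂ = record
    { pairs     = pairs
    ; isPairing = record
      { distinct  = All.++⁺ (All.map⁺ (All.map (_∘ E₁.edge-injective) (distinct W₁.isPairing)))
                            (All.map⁺ (All.map (_∘ E₂.edge-injective) (distinct W₂.isPairing)))
      ; separated = all²-++
          (All.map⁺ (All.map (All.map⁺ ∘ All.map E₁.separated-edgePair) (separated W₁.isPairing)))
          (all²-map (λ p q → edge-disjoint⇒separated (pairs-edgeDisjoint p q)) W₁.pairs W₂.pairs)
          (all²-map (λ q p → edge-disjoint⇒separated λ x∈q x∈p → pairs-edgeDisjoint p q x∈p x∈q)
                 W₂.pairs W₁.pairs)
          (All.map⁺ (All.map (All.map⁺ ∘ All.map E₂.separated-edgePair) (separated W₂.isPairing)))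
      }
    ; forcing   = forcing
    }
    where
    module W₁ = WinningPairing W₁
    module W₂ = WinningPairing W₂
    open IsPairing

    pairs : List (EdgePair a b)
    pairs = map E₁.edgePair W₁.pairs ++ map E₂.edgePair W₂.pairs

    forcing : ∀ S → Meets S pairs → SaturatingMatchingIn S
    forcing S meets
      with meets₁ , meets₂ ← All.++⁻ (map E₁.edgePair W₁.pairs) meets
      with ms₁ , ms₁⊆S , ms₁-disjoint , ms₁-covers ← W₁.forcing (S ∘ E₁.edge) (All.map⁻ meets₁)
         | ms₂ , ms₂⊆S , ms₂-disjoint , ms₂-covers ← W₂.forcing (S ∘ E₂.edge) (All.map⁻ meets₂)
      = map E₁.edge ms₁ ++ map E₂.edge ms₂
      , All.++⁺ (All.map⁺ ms₁⊆S) (All.map⁺ ms₂⊆S)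
      , AllPairs.++⁺ (AllPairs.map⁺ (AllPairs.map E₁.disjoint-edge ms₁-disjoint))
                     (AllPairs.map⁺ (AllPairs.map E₂.disjoint-edge ms₂-disjoint))
                     (all²-map edges-vertexDisjoint ms₁ ms₂)
      , covers
      where
      covers : (k : Fin a) → Any (Incident (inj₁ k)) (map E₁.edge ms₁ ++ map E₂.edge ms₂)
      covers k with coverA k
      ... | inj₁ (i , refl) = Any.++⁺ˡ (Any.map⁺ (Any.map E₁.incident-edge (ms₁-covers i)))
      ... | inj₂ (j , refl) = Any.++⁺ʳ (map E₁.edge ms₁) (Any.map⁺ (Any.map E₂.incident-edge (ms₂-covers j)))

emptyPairing : ∀ b → WinningPairing 0 b
emptyPairing b = record
  { pairs     = []
  ; isPairing = record { distinct = [] ; separated = [] }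
  ; forcing   = λ _ _ → [] , [] , AllPairs.[] , λ ()
  }

combineA : ∀ a₁ a₂ b → WinningPairing a₁ 0 → WinningPairing a₂ b → WinningPairing (a₁ + a₂) b
combineA a₁ a₂ b = Combine.combine left right disjointA (λ ()) coverA
  where
  left : Embedding a₁ 0 (a₁ + a₂) b
  left = record
    { onA           = _↑ˡ a₂
    ; onA-mono      = λ {i} {j} i<j → subst₂ ℕ._<_ (sym (Fin.toℕ-↑ˡ i a₂)) (sym (Fin.toℕ-↑ˡ j a₂)) i<j
    ; onB           = λ ()
    ; onB-injective = λ { {()} }
    }
  right : Embedding a₂ b (a₁ + a₂) b
  right = record
    { onA           = a₁ ↑ʳ_
    ; onA-mono      = λ {i} {j} i<j →
        subst₂ ℕ._<_ (sym (Fin.toℕ-↑ʳ a₁ i)) (sym (Fin.toℕ-↑ʳ a₁ j)) (ℕ.+-monoʳ-< a₁ i<j)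
    ; onB           = λ j → j
    ; onB-injective = λ eq → eq
    }
  disjointA : ∀ i j → i ↑ˡ a₂ ≢ a₁ ↑ʳ j
  disjointA i j eq = ℕ.<⇒≢ (ℕ.<-≤-trans (Fin.toℕ<n i) (ℕ.m≤m+n a₁ (toℕ j)))
    (trans (sym (Fin.toℕ-↑ˡ i a₂)) (trans (cong toℕ eq) (Fin.toℕ-↑ʳ a₁ j)))
  coverA : ∀ k → (∃ λ i → i ↑ˡ a₂ ≡ k) ⊎ (∃ λ j → a₁ ↑ʳ j ≡ k)
  coverA k with splitAt a₁ k in eq
  ... | inj₁ i = inj₁ (i , Fin.splitAt⁻¹-↑ˡ eq)
  ... | inj₂ j = inj₂ (j , Fin.splitAt⁻¹-↑ʳ eq)

extendB : ∀ {a b b′} → b ≤ b′ → WinningPairing a b → WinningPairing a b′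
extendB {a} {b} {b′} b≤b′ W =
  Combine.combine inclusion nothing (λ _ ()) (λ _ ()) (λ k → inj₁ (k , refl)) W (emptyPairing 0)
  where
  inclusion : Embedding a b a b′
  inclusion = record
    { onA           = λ i → i
    ; onA-mono      = λ i<j → i<j
    ; onB           = λ j → inject≤ j b≤b′
    ; onB-injective = Fin.inject≤-injective b≤b′ b≤b′ _ _
    }
  nothing : Embedding 0 0 a b′
  nothing = record { onA = λ () ; onA-mono = λ { {()} } ; onB = λ () ; onB-injective = λ { {()} } }
_≟ₚ_ : ∀ {a b} → DecidableEquality (EdgePair a b)
_≟ₚ_ = Product.≡-dec _≟ᴱ_ _≟ᴱ_

ends : ∀ {a b} → Edge a b → List (Vertex a b)
ends (aa i j _) = inj₁ i ∷ inj₁ j ∷ []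
ends (ab i j)   = inj₁ i ∷ inj₂ j ∷ []

incident⇒∈ends : ∀ {a b} {v : Vertex a b} {e : Edge a b} → Incident v e → v ∈ ends e
incident⇒∈ends (aa-left _)  = here refl
incident⇒∈ends (aa-right _) = there (here refl)
incident⇒∈ends ab-left      = here refl
incident⇒∈ends ab-right     = there (here refl)

incident? : ∀ {a b} (v : Vertex a b) (e : Edge a b) → Dec (Incident v e)
incident? (inj₁ k) (aa i j i<j) with k Fin.≟ i | k Fin.≟ j
... | yes refl | _        = yes (aa-left i<j)
... | no _     | yes refl = yes (aa-right i<j)
... | no k≢i   | no k≢j   = no λ { (aa-left _) → k≢i refl ; (aa-right _) → k≢j refl }
incident? (inj₁ k) (ab i _) with k Fin.≟ i
... | yes refl = yes ab-left
... | no k≢i   = no λ { ab-left → k≢i refl }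
incident? (inj₂ _) (aa _ _ _) = no λ ()
incident? (inj₂ k) (ab _ j) with k Fin.≟ j
... | yes refl = yes ab-right
... | no k≢j   = no λ { ab-right → k≢j refl }

∈ends⇒incident : ∀ {a b} {v : Vertex a b} {e : Edge a b} → v ∈ ends e → Incident v e
∈ends⇒incident {e = aa _ _ i<j} (here refl)         = aa-left i<j
∈ends⇒incident {e = aa _ _ i<j} (there (here refl)) = aa-right i<j
∈ends⇒incident {e = ab _ _}     (here refl)         = ab-left
∈ends⇒incident {e = ab _ _}     (there (here refl)) = ab-right

vertexDisjoint? : ∀ {a b} (e f : Edge a b) → Dec (VertexDisjoint e f)
vertexDisjoint? e f = map′
  (λ ends-free v v∈e → All.lookup ends-free (incident⇒∈ends v∈e))
  (λ disj → All.tabulate λ v∈ends → disj _ (∈ends⇒incident v∈ends))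
  (all? (λ v → ¬? (incident? v f)) (ends e))

isPairing? : ∀ {a b} (P : List (EdgePair a b)) → Dec (IsPairing P)
isPairing? P = map′ (Product.uncurry IsPairing.constructor) (λ r → IsPairing.distinct r , IsPairing.separated r)
  (all? (λ p → ¬? (proj₁ p ≟ᴱ proj₂ p)) P ×-dec
   all? (λ p → all? (λ q → (proj₁ p ∈ₚ? q ⊎-dec proj₂ p ∈ₚ? q) →-dec
                           (p ≟ₚ q ⊎-dec p ≟ₚ swap q)) P) P)

aa′ : ∀ {a b} (i j : Fin a) {i<j : True (i Fin.<? j)} → Edge a b
aa′ i j {i<j} = aa i j (toWitness i<j)

module Certificate {a b : ℕ} (P : List (EdgePair a b)) where
  open DecMembership (_≟ᴱ_ {a} {b}) using (_∈?_)
  open DecMembership (_≟ₚ_ {a} {b}) using () renaming (_∈?_ to _∈ᴾ?_)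

  -- At a node the set S contains one of the two edges of a pair of P; at a leaf,
  -- the edges collected on the way to it contain a saturating matching.
  data CaseTree : Set where
    leaf : List (Edge a b) → CaseTree
    node : Edge a b → Edge a b → CaseTree → CaseTree → CaseTree

  Certifies : CaseTree → List (Edge a b) → Set
  Certifies (leaf ms) chosen =
    All (_∈ chosen) ms × AllPairs VertexDisjoint ms × ((i : Fin a) → Any (Incident (inj₁ i)) ms)
  Certifies (node e f t u) chosen =
    (e , f) ∈ P × Certifies t (e ∷ chosen) × Certifies u (f ∷ chosen)

  certifies? : ∀ t chosen → Dec (Certifies t chosen)
  certifies? (leaf ms) chosen =
    all? (_∈? chosen) ms ×-dec AllPairs.allPairs? vertexDisjoint? ms ×-dec
    Fin.all? (λ i → any? (incident? (inj₁ i)) ms)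
  certifies? (node e f t u) chosen =
    (e , f) ∈ᴾ? P ×-dec certifies? t (e ∷ chosen) ×-dec certifies? u (f ∷ chosen)

  certifies⇒matching : ∀ t {chosen} S → Certifies t chosen → All S chosen → Meets S P →
                       SaturatingMatchingIn S
  certifies⇒matching (leaf ms) S (ms⊆chosen , disjoint , covers) chosen⊆S _ =
    ms , All.map (All.lookup chosen⊆S) ms⊆chosen , disjoint , covers
  certifies⇒matching (node e f t u) S (p∈P , cert-t , cert-u) chosen⊆S meets
    with All.lookup meets p∈P
  ... | inj₁ e∈S = certifies⇒matching t S cert-t (e∈S ∷ chosen⊆S) meets
  ... | inj₂ f∈S = certifies⇒matching u S cert-u (f∈S ∷ chosen⊆S) meets

  fromCertificate : (t : CaseTree) {_ : True (certifies? t [])} {_ : True (isPairing? P)} →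
                    WinningPairing a b
  fromCertificate t {cert} {pairing} = record
    { pairs     = P
    ; isPairing = toWitness pairing
    ; forcing   = λ S → certifies⇒matching t S (toWitness cert) []
    }

pairing12 : WinningPairing 1 2
pairing12 = fromCertificate tree
  where
  open Certificate
    ( (ab (# 0) (# 0) , ab (# 0) (# 1))
    ∷ [])
  tree : CaseTree
  tree =
    node (ab (# 0) (# 0)) (ab (# 0) (# 1))
      (leaf (ab (# 0) (# 0) ∷ []))
      (leaf (ab (# 0) (# 1) ∷ []))

pairing23 : WinningPairing 2 3
pairing23 = fromCertificate tree
  where
  open Certificate
    ( (aa′ (# 0) (# 1) , ab (# 0) (# 0))
    ∷ (ab (# 0) (# 1) , ab (# 0) (# 2))
    ∷ (ab (# 1) (# 0) , ab (# 1) (# 1))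
    ∷ [])
  tree : CaseTree
  tree =
    node (aa′ (# 0) (# 1)) (ab (# 0) (# 0))
      (leaf (aa′ (# 0) (# 1) ∷ []))
      (node (ab (# 1) (# 0)) (ab (# 1) (# 1))
        (node (ab (# 0) (# 1)) (ab (# 0) (# 2))
          (leaf (ab (# 0) (# 1) ∷ ab (# 1) (# 0) ∷ []))
          (leaf (ab (# 0) (# 2) ∷ ab (# 1) (# 0) ∷ [])))
        (leaf (ab (# 0) (# 0) ∷ ab (# 1) (# 1) ∷ [])))

pairing33 : WinningPairing 3 3
pairing33 = fromCertificate tree
  where
  open Certificate
    ( (aa′ (# 0) (# 1) , aa′ (# 0) (# 2))
    ∷ (ab (# 0) (# 0) , ab (# 0) (# 1))
    ∷ (ab (# 0) (# 2) , aa′ (# 1) (# 2))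
    ∷ (ab (# 1) (# 0) , ab (# 1) (# 1))
    ∷ (ab (# 1) (# 2) , ab (# 2) (# 0))
    ∷ (ab (# 2) (# 1) , ab (# 2) (# 2))
    ∷ [])
  tree : CaseTree
  tree =
    node (aa′ (# 0) (# 1)) (aa′ (# 0) (# 2))
      (node (ab (# 2) (# 1)) (ab (# 2) (# 2))
        (leaf (aa′ (# 0) (# 1) ∷ ab (# 2) (# 1) ∷ []))
        (leaf (aa′ (# 0) (# 1) ∷ ab (# 2) (# 2) ∷ [])))
      (node (ab (# 1) (# 0)) (ab (# 1) (# 1))
        (leaf (aa′ (# 0) (# 2) ∷ ab (# 1) (# 0) ∷ []))
        (leaf (aa′ (# 0) (# 2) ∷ ab (# 1) (# 1) ∷ [])))

pairing44 : WinningPairing 4 4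
pairing44 = fromCertificate tree
  where
  open Certificate
    ( (ab (# 1) (# 1) , ab (# 1) (# 3))
    ∷ (ab (# 3) (# 0) , ab (# 0) (# 0))
    ∷ (aa′ (# 0) (# 1) , ab (# 3) (# 1))
    ∷ (ab (# 1) (# 2) , aa′ (# 0) (# 3))
    ∷ (ab (# 0) (# 3) , ab (# 1) (# 0))
    ∷ (ab (# 0) (# 2) , ab (# 0) (# 1))
    ∷ (aa′ (# 1) (# 2) , ab (# 2) (# 3))
    ∷ (ab (# 2) (# 2) , ab (# 2) (# 1))
    ∷ (ab (# 3) (# 2) , ab (# 2) (# 0))
    ∷ (aa′ (# 1) (# 3) , aa′ (# 0) (# 2))
    ∷ (aa′ (# 2) (# 3) , ab (# 3) (# 3))
    ∷ [])
  tree : CaseTree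
  tree =
    node (ab (# 1) (# 1)) (ab (# 1) (# 3))
      (node (ab (# 3) (# 0)) (ab (# 0) (# 0))
        (node (aa′ (# 1) (# 3)) (aa′ (# 0) (# 2))
          (node (aa′ (# 0) (# 1)) (ab (# 3) (# 1))
            (node (ab (# 2) (# 2)) (ab (# 2) (# 1))
              (leaf (aa′ (# 0) (# 1) ∷ ab (# 2) (# 2) ∷ ab (# 3) (# 0) ∷ []))
              (leaf (aa′ (# 0) (# 1) ∷ ab (# 2) (# 1) ∷ ab (# 3) (# 0) ∷ [])))
            (node (ab (# 1) (# 2)) (aa′ (# 0) (# 3))
              (node (ab (# 0) (# 3)) (ab (# 1) (# 0))
                (node (ab (# 2) (# 2)) (ab (# 2) (# 1))
                  (leaf (ab (# 0) (# 3) ∷ ab (# 1) (# 1) ∷ ab (# 2) (# 2) ∷ ab (# 3) (# 0) ∷ []))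
                  (leaf (ab (# 0) (# 3) ∷ aa′ (# 1) (# 3) ∷ ab (# 2) (# 1) ∷ [])))
                (node (ab (# 0) (# 2)) (ab (# 0) (# 1))
                  (node (aa′ (# 1) (# 2)) (ab (# 2) (# 3))
                    (leaf (ab (# 0) (# 2) ∷ aa′ (# 1) (# 2) ∷ ab (# 3) (# 0) ∷ []))
                    (leaf (ab (# 0) (# 2) ∷ ab (# 1) (# 1) ∷ ab (# 2) (# 3) ∷ ab (# 3) (# 0) ∷ [])))
                  (node (aa′ (# 1) (# 2)) (ab (# 2) (# 3))
                    (leaf (ab (# 0) (# 1) ∷ aa′ (# 1) (# 2) ∷ ab (# 3) (# 0) ∷ []))
                    (leaf (ab (# 0) (# 1) ∷ aa′ (# 1) (# 3) ∷ ab (# 2) (# 3) ∷ [])))))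
              (node (aa′ (# 1) (# 2)) (ab (# 2) (# 3))
                (leaf (aa′ (# 0) (# 3) ∷ aa′ (# 1) (# 2) ∷ []))
                (leaf (aa′ (# 0) (# 3) ∷ ab (# 1) (# 1) ∷ ab (# 2) (# 3) ∷ [])))))
          (leaf (aa′ (# 0) (# 2) ∷ ab (# 1) (# 1) ∷ ab (# 3) (# 0) ∷ [])))
        (node (aa′ (# 2) (# 3)) (ab (# 3) (# 3))
          (leaf (ab (# 0) (# 0) ∷ ab (# 1) (# 1) ∷ aa′ (# 2) (# 3) ∷ []))
          (node (aa′ (# 1) (# 2)) (ab (# 2) (# 3))
            (leaf (ab (# 0) (# 0) ∷ aa′ (# 1) (# 2) ∷ ab (# 3) (# 3) ∷ []))
            (node (aa′ (# 1) (# 3)) (aa′ (# 0) (# 2))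
              (leaf (ab (# 0) (# 0) ∷ aa′ (# 1) (# 3) ∷ ab (# 2) (# 3) ∷ []))
              (leaf (aa′ (# 0) (# 2) ∷ ab (# 1) (# 1) ∷ ab (# 3) (# 3) ∷ []))))))
      (node (ab (# 3) (# 0)) (ab (# 0) (# 0))
        (node (aa′ (# 1) (# 3)) (aa′ (# 0) (# 2))
          (node (aa′ (# 0) (# 1)) (ab (# 3) (# 1))
            (node (ab (# 2) (# 2)) (ab (# 2) (# 1))
              (leaf (aa′ (# 0) (# 1) ∷ ab (# 2) (# 2) ∷ ab (# 3) (# 0) ∷ []))
              (leaf (aa′ (# 0) (# 1) ∷ ab (# 2) (# 1) ∷ ab (# 3) (# 0) ∷ [])))
            (node (ab (# 1) (# 2)) (aa′ (# 0) (# 3))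
              (node (ab (# 0) (# 3)) (ab (# 1) (# 0))
                (node (ab (# 2) (# 2)) (ab (# 2) (# 1))
                  (leaf (ab (# 0) (# 3) ∷ aa′ (# 1) (# 3) ∷ ab (# 2) (# 2) ∷ []))
                  (leaf (ab (# 0) (# 3) ∷ aa′ (# 1) (# 3) ∷ ab (# 2) (# 1) ∷ [])))
                (node (ab (# 0) (# 2)) (ab (# 0) (# 1))
                  (node (aa′ (# 1) (# 2)) (ab (# 2) (# 3))
                    (leaf (ab (# 0) (# 2) ∷ aa′ (# 1) (# 2) ∷ ab (# 3) (# 0) ∷ []))
                    (leaf (ab (# 0) (# 2) ∷ aa′ (# 1) (# 3) ∷ ab (# 2) (# 3) ∷ [])))
                  (node (aa′ (# 1) (# 2)) (ab (# 2) (# 3))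
                    (leaf (ab (# 0) (# 1) ∷ aa′ (# 1) (# 2) ∷ ab (# 3) (# 0) ∷ []))
                    (leaf (ab (# 0) (# 1) ∷ aa′ (# 1) (# 3) ∷ ab (# 2) (# 3) ∷ [])))))
              (node (ab (# 2) (# 2)) (ab (# 2) (# 1))
                (leaf (aa′ (# 0) (# 3) ∷ ab (# 1) (# 3) ∷ ab (# 2) (# 2) ∷ []))
                (leaf (aa′ (# 0) (# 3) ∷ ab (# 1) (# 3) ∷ ab (# 2) (# 1) ∷ [])))))
          (leaf (aa′ (# 0) (# 2) ∷ ab (# 1) (# 3) ∷ ab (# 3) (# 0) ∷ [])))
        (node (aa′ (# 2) (# 3)) (ab (# 3) (# 3))
          (leaf (ab (# 0) (# 0) ∷ ab (# 1) (# 3) ∷ aa′ (# 2) (# 3) ∷ []))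
          (node (aa′ (# 1) (# 2)) (ab (# 2) (# 3))
            (leaf (ab (# 0) (# 0) ∷ aa′ (# 1) (# 2) ∷ ab (# 3) (# 3) ∷ []))
            (node (aa′ (# 1) (# 3)) (aa′ (# 0) (# 2))
              (leaf (ab (# 0) (# 0) ∷ aa′ (# 1) (# 3) ∷ ab (# 2) (# 3) ∷ []))
              (node (aa′ (# 0) (# 1)) (ab (# 3) (# 1))
                (node (ab (# 2) (# 2)) (ab (# 2) (# 1))
                  (leaf (aa′ (# 0) (# 1) ∷ ab (# 2) (# 2) ∷ ab (# 3) (# 3) ∷ []))
                  (leaf (aa′ (# 0) (# 1) ∷ ab (# 2) (# 1) ∷ ab (# 3) (# 3) ∷ [])))
                (leaf (aa′ (# 0) (# 2) ∷ ab (# 1) (# 3) ∷ ab (# 3) (# 1) ∷ [])))))))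

pairing54 : WinningPairing 5 4
pairing54 = fromCertificate tree
  where
  open Certificate
    ( (ab (# 4) (# 0) , aa′ (# 2) (# 4))
    ∷ (ab (# 1) (# 0) , aa′ (# 1) (# 4))
    ∷ (ab (# 3) (# 1) , ab (# 1) (# 3))
    ∷ (ab (# 4) (# 3) , ab (# 0) (# 1))
    ∷ (ab (# 0) (# 3) , ab (# 0) (# 0))
    ∷ (aa′ (# 1) (# 2) , ab (# 4) (# 2))
    ∷ (ab (# 2) (# 0) , ab (# 1) (# 2))
    ∷ (aa′ (# 0) (# 1) , ab (# 2) (# 2))
    ∷ (ab (# 3) (# 0) , aa′ (# 2) (# 3))
    ∷ (ab (# 1) (# 1) , aa′ (# 3) (# 4))
    ∷ (aa′ (# 0) (# 2) , ab (# 0) (# 2))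
    ∷ (aa′ (# 0) (# 4) , aa′ (# 1) (# 3))
    ∷ (aa′ (# 0) (# 3) , ab (# 3) (# 2))
    ∷ (ab (# 3) (# 3) , ab (# 4) (# 1))
    ∷ (ab (# 2) (# 1) , ab (# 2) (# 3))
    ∷ [])
  tree : CaseTree
  tree =
    node (ab (# 4) (# 0)) (aa′ (# 2) (# 4))
      (node (ab (# 1) (# 0)) (aa′ (# 1) (# 4))
        (node (ab (# 3) (# 1)) (ab (# 1) (# 3))
          (node (ab (# 4) (# 3)) (ab (# 0) (# 1))
            (node (aa′ (# 0) (# 2)) (ab (# 0) (# 2))
              (leaf (aa′ (# 0) (# 2) ∷ ab (# 1) (# 0) ∷ ab (# 3) (# 1) ∷ ab (# 4) (# 3) ∷ []))
              (node (aa′ (# 1) (# 2)) (ab (# 4) (# 2))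
                (leaf (ab (# 0) (# 2) ∷ aa′ (# 1) (# 2) ∷ ab (# 3) (# 1) ∷ ab (# 4) (# 0) ∷ []))
                (node (ab (# 3) (# 0)) (aa′ (# 2) (# 3))
                  (node (ab (# 0) (# 3)) (ab (# 0) (# 0))
                    (node (ab (# 2) (# 0)) (ab (# 1) (# 2))
                      (node (aa′ (# 0) (# 1)) (ab (# 2) (# 2))
                        (leaf (aa′ (# 0) (# 1) ∷ ab (# 2) (# 0) ∷ ab (# 3) (# 1) ∷ ab (# 4) (# 3) ∷ []))
                        (node (aa′ (# 0) (# 4)) (aa′ (# 1) (# 3))
                          (leaf (aa′ (# 0) (# 4) ∷ ab (# 1) (# 0) ∷ ab (# 2) (# 2) ∷ ab (# 3) (# 1) ∷ []))
                          (leaf (ab (# 0) (# 2) ∷ aa′ (# 1) (# 3) ∷ ab (# 2) (# 0) ∷ ab (# 4) (# 3) ∷ []))))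
                      (node (aa′ (# 0) (# 1)) (ab (# 2) (# 2))
                        (node (ab (# 2) (# 1)) (ab (# 2) (# 3))
                          (leaf (aa′ (# 0) (# 1) ∷ ab (# 2) (# 1) ∷ ab (# 3) (# 0) ∷ ab (# 4) (# 3) ∷ []))
                          (leaf (aa′ (# 0) (# 1) ∷ ab (# 2) (# 3) ∷ ab (# 3) (# 1) ∷ ab (# 4) (# 0) ∷ [])))
                        (node (aa′ (# 0) (# 4)) (aa′ (# 1) (# 3))
                          (leaf (aa′ (# 0) (# 4) ∷ ab (# 1) (# 0) ∷ ab (# 2) (# 2) ∷ ab (# 3) (# 1) ∷ []))
                          (leaf (ab (# 0) (# 3) ∷ aa′ (# 1) (# 3) ∷ ab (# 2) (# 2) ∷ ab (# 4) (# 0) ∷ [])))))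
                    (node (ab (# 2) (# 0)) (ab (# 1) (# 2))
                      (node (aa′ (# 0) (# 1)) (ab (# 2) (# 2))
                        (leaf (aa′ (# 0) (# 1) ∷ ab (# 2) (# 0) ∷ ab (# 3) (# 1) ∷ ab (# 4) (# 3) ∷ []))
                        (node (aa′ (# 0) (# 4)) (aa′ (# 1) (# 3))
                          (leaf (aa′ (# 0) (# 4) ∷ ab (# 1) (# 0) ∷ ab (# 2) (# 2) ∷ ab (# 3) (# 1) ∷ []))
                          (leaf (ab (# 0) (# 2) ∷ aa′ (# 1) (# 3) ∷ ab (# 2) (# 0) ∷ ab (# 4) (# 3) ∷ []))))
                      (node (aa′ (# 0) (# 1)) (ab (# 2) (# 2))
                        (node (ab (# 2) (# 1)) (ab (# 2) (# 3))
                          (leaf (aa′ (# 0) (# 1) ∷ ab (# 2) (# 1) ∷ ab (# 3) (# 0) ∷ ab (# 4) (# 3) ∷ []))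
                          (leaf (aa′ (# 0) (# 1) ∷ ab (# 2) (# 3) ∷ ab (# 3) (# 1) ∷ ab (# 4) (# 0) ∷ [])))
                        (node (aa′ (# 0) (# 4)) (aa′ (# 1) (# 3))
                          (leaf (aa′ (# 0) (# 4) ∷ ab (# 1) (# 0) ∷ ab (# 2) (# 2) ∷ ab (# 3) (# 1) ∷ []))
                          (leaf (ab (# 0) (# 0) ∷ aa′ (# 1) (# 3) ∷ ab (# 2) (# 2) ∷ ab (# 4) (# 3) ∷ []))))))
                  (leaf (ab (# 0) (# 2) ∷ ab (# 1) (# 0) ∷ aa′ (# 2) (# 3) ∷ ab (# 4) (# 3) ∷ [])))))
            (node (ab (# 0) (# 3)) (ab (# 0) (# 0))
              (node (aa′ (# 1) (# 2)) (ab (# 4) (# 2))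
                (leaf (ab (# 0) (# 3) ∷ aa′ (# 1) (# 2) ∷ ab (# 3) (# 1) ∷ ab (# 4) (# 0) ∷ []))
                (node (ab (# 3) (# 0)) (aa′ (# 2) (# 3))
                  (node (aa′ (# 0) (# 2)) (ab (# 0) (# 2))
                    (leaf (aa′ (# 0) (# 2) ∷ ab (# 1) (# 0) ∷ ab (# 3) (# 1) ∷ ab (# 4) (# 2) ∷ []))
                    (node (ab (# 2) (# 0)) (ab (# 1) (# 2))
                      (node (aa′ (# 0) (# 1)) (ab (# 2) (# 2))
                        (leaf (aa′ (# 0) (# 1) ∷ ab (# 2) (# 0) ∷ ab (# 3) (# 1) ∷ ab (# 4) (# 2) ∷ []))
                        (node (aa′ (# 0) (# 4)) (aa′ (# 1) (# 3))
                          (leaf (aa′ (# 0) (# 4) ∷ ab (# 1) (# 0) ∷ ab (# 2) (# 2) ∷ ab (# 3) (# 1) ∷ []))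
                          (leaf (ab (# 0) (# 1) ∷ aa′ (# 1) (# 3) ∷ ab (# 2) (# 0) ∷ ab (# 4) (# 2) ∷ []))))
                      (node (aa′ (# 0) (# 1)) (ab (# 2) (# 2))
                        (node (ab (# 2) (# 1)) (ab (# 2) (# 3))
                          (leaf (aa′ (# 0) (# 1) ∷ ab (# 2) (# 1) ∷ ab (# 3) (# 0) ∷ ab (# 4) (# 2) ∷ []))
                          (leaf (aa′ (# 0) (# 1) ∷ ab (# 2) (# 3) ∷ ab (# 3) (# 1) ∷ ab (# 4) (# 0) ∷ [])))
                        (node (aa′ (# 0) (# 4)) (aa′ (# 1) (# 3))
                          (leaf (aa′ (# 0) (# 4) ∷ ab (# 1) (# 0) ∷ ab (# 2) (# 2) ∷ ab (# 3) (# 1) ∷ []))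
                          (leaf (ab (# 0) (# 1) ∷ aa′ (# 1) (# 3) ∷ ab (# 2) (# 2) ∷ ab (# 4) (# 0) ∷ []))))))
                  (leaf (ab (# 0) (# 1) ∷ ab (# 1) (# 0) ∷ aa′ (# 2) (# 3) ∷ ab (# 4) (# 2) ∷ []))))
              (node (aa′ (# 1) (# 2)) (ab (# 4) (# 2))
                (node (aa′ (# 0) (# 3)) (ab (# 3) (# 2))
                  (leaf (aa′ (# 0) (# 3) ∷ aa′ (# 1) (# 2) ∷ ab (# 4) (# 0) ∷ []))
                  (leaf (ab (# 0) (# 1) ∷ aa′ (# 1) (# 2) ∷ ab (# 3) (# 2) ∷ ab (# 4) (# 0) ∷ [])))
                (node (ab (# 3) (# 0)) (aa′ (# 2) (# 3))
                  (node (aa′ (# 0) (# 2)) (ab (# 0) (# 2))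
                    (leaf (aa′ (# 0) (# 2) ∷ ab (# 1) (# 0) ∷ ab (# 3) (# 1) ∷ ab (# 4) (# 2) ∷ []))
                    (node (ab (# 2) (# 0)) (ab (# 1) (# 2))
                      (node (aa′ (# 0) (# 1)) (ab (# 2) (# 2))
                        (leaf (aa′ (# 0) (# 1) ∷ ab (# 2) (# 0) ∷ ab (# 3) (# 1) ∷ ab (# 4) (# 2) ∷ []))
                        (node (aa′ (# 0) (# 4)) (aa′ (# 1) (# 3))
                          (leaf (aa′ (# 0) (# 4) ∷ ab (# 1) (# 0) ∷ ab (# 2) (# 2) ∷ ab (# 3) (# 1) ∷ []))
                          (leaf (ab (# 0) (# 1) ∷ aa′ (# 1) (# 3) ∷ ab (# 2) (# 0) ∷ ab (# 4) (# 2) ∷ []))))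
                      (node (aa′ (# 0) (# 1)) (ab (# 2) (# 2))
                        (node (ab (# 2) (# 1)) (ab (# 2) (# 3))
                          (leaf (aa′ (# 0) (# 1) ∷ ab (# 2) (# 1) ∷ ab (# 3) (# 0) ∷ ab (# 4) (# 2) ∷ []))
                          (leaf (aa′ (# 0) (# 1) ∷ ab (# 2) (# 3) ∷ ab (# 3) (# 1) ∷ ab (# 4) (# 0) ∷ [])))
                        (node (aa′ (# 0) (# 4)) (aa′ (# 1) (# 3))
                          (leaf (aa′ (# 0) (# 4) ∷ ab (# 1) (# 0) ∷ ab (# 2) (# 2) ∷ ab (# 3) (# 1) ∷ []))
                          (leaf (ab (# 0) (# 1) ∷ aa′ (# 1) (# 3) ∷ ab (# 2) (# 2) ∷ ab (# 4) (# 0) ∷ []))))))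
                  (leaf (ab (# 0) (# 1) ∷ ab (# 1) (# 0) ∷ aa′ (# 2) (# 3) ∷ ab (# 4) (# 2) ∷ []))))))
          (node (ab (# 4) (# 3)) (ab (# 0) (# 1))
            (node (ab (# 0) (# 3)) (ab (# 0) (# 0))
              (node (aa′ (# 1) (# 2)) (ab (# 4) (# 2))
                (node (aa′ (# 0) (# 3)) (ab (# 3) (# 2))
                  (leaf (aa′ (# 0) (# 3) ∷ aa′ (# 1) (# 2) ∷ ab (# 4) (# 0) ∷ []))
                  (leaf (ab (# 0) (# 3) ∷ aa′ (# 1) (# 2) ∷ ab (# 3) (# 2) ∷ ab (# 4) (# 0) ∷ [])))
                (node (ab (# 3) (# 0)) (aa′ (# 2) (# 3))
                  (node (aa′ (# 0) (# 2)) (ab (# 0) (# 2))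
                    (leaf (aa′ (# 0) (# 2) ∷ ab (# 1) (# 3) ∷ ab (# 3) (# 0) ∷ ab (# 4) (# 2) ∷ []))
                    (node (ab (# 2) (# 0)) (ab (# 1) (# 2))
                      (node (ab (# 1) (# 1)) (aa′ (# 3) (# 4))
                        (node (aa′ (# 0) (# 4)) (aa′ (# 1) (# 3))
                          (node (aa′ (# 0) (# 3)) (ab (# 3) (# 2))
                            (leaf (aa′ (# 0) (# 3) ∷ ab (# 1) (# 3) ∷ ab (# 2) (# 0) ∷ ab (# 4) (# 2) ∷ []))
                            (leaf (aa′ (# 0) (# 4) ∷ ab (# 1) (# 3) ∷ ab (# 2) (# 0) ∷ ab (# 3) (# 2) ∷ [])))
                          (leaf (ab (# 0) (# 3) ∷ aa′ (# 1) (# 3) ∷ ab (# 2) (# 0) ∷ ab (# 4) (# 2) ∷ [])))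
                        (leaf (ab (# 0) (# 2) ∷ ab (# 1) (# 3) ∷ ab (# 2) (# 0) ∷ aa′ (# 3) (# 4) ∷ [])))
                      (node (aa′ (# 0) (# 1)) (ab (# 2) (# 2))
                        (node (ab (# 2) (# 1)) (ab (# 2) (# 3))
                          (leaf (aa′ (# 0) (# 1) ∷ ab (# 2) (# 1) ∷ ab (# 3) (# 0) ∷ ab (# 4) (# 3) ∷ []))
                          (leaf (aa′ (# 0) (# 1) ∷ ab (# 2) (# 3) ∷ ab (# 3) (# 0) ∷ ab (# 4) (# 2) ∷ [])))
                        (node (aa′ (# 0) (# 4)) (aa′ (# 1) (# 3))
                          (leaf (aa′ (# 0) (# 4) ∷ ab (# 1) (# 3) ∷ ab (# 2) (# 2) ∷ ab (# 3) (# 0) ∷ []))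
                          (leaf (ab (# 0) (# 3) ∷ aa′ (# 1) (# 3) ∷ ab (# 2) (# 2) ∷ ab (# 4) (# 0) ∷ []))))))
                  (leaf (ab (# 0) (# 3) ∷ ab (# 1) (# 0) ∷ aa′ (# 2) (# 3) ∷ ab (# 4) (# 2) ∷ []))))
              (node (aa′ (# 1) (# 2)) (ab (# 4) (# 2))
                (node (aa′ (# 0) (# 3)) (ab (# 3) (# 2))
                  (leaf (aa′ (# 0) (# 3) ∷ aa′ (# 1) (# 2) ∷ ab (# 4) (# 0) ∷ []))
                  (leaf (ab (# 0) (# 0) ∷ aa′ (# 1) (# 2) ∷ ab (# 3) (# 2) ∷ ab (# 4) (# 3) ∷ [])))
                (node (ab (# 3) (# 0)) (aa′ (# 2) (# 3))
                  (node (aa′ (# 0) (# 2)) (ab (# 0) (# 2))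
                    (leaf (aa′ (# 0) (# 2) ∷ ab (# 1) (# 3) ∷ ab (# 3) (# 0) ∷ ab (# 4) (# 2) ∷ []))
                    (node (ab (# 2) (# 0)) (ab (# 1) (# 2))
                      (node (ab (# 1) (# 1)) (aa′ (# 3) (# 4))
                        (node (aa′ (# 0) (# 4)) (aa′ (# 1) (# 3))
                          (node (aa′ (# 0) (# 3)) (ab (# 3) (# 2))
                            (leaf (aa′ (# 0) (# 3) ∷ ab (# 1) (# 3) ∷ ab (# 2) (# 0) ∷ ab (# 4) (# 2) ∷ []))
                            (leaf (aa′ (# 0) (# 4) ∷ ab (# 1) (# 3) ∷ ab (# 2) (# 0) ∷ ab (# 3) (# 2) ∷ [])))
                          (leaf (ab (# 0) (# 2) ∷ aa′ (# 1) (# 3) ∷ ab (# 2) (# 0) ∷ ab (# 4) (# 3) ∷ [])))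
                        (leaf (ab (# 0) (# 2) ∷ ab (# 1) (# 3) ∷ ab (# 2) (# 0) ∷ aa′ (# 3) (# 4) ∷ [])))
                      (node (aa′ (# 0) (# 1)) (ab (# 2) (# 2))
                        (node (ab (# 2) (# 1)) (ab (# 2) (# 3))
                          (leaf (aa′ (# 0) (# 1) ∷ ab (# 2) (# 1) ∷ ab (# 3) (# 0) ∷ ab (# 4) (# 3) ∷ []))
                          (leaf (aa′ (# 0) (# 1) ∷ ab (# 2) (# 3) ∷ ab (# 3) (# 0) ∷ ab (# 4) (# 2) ∷ [])))
                        (node (aa′ (# 0) (# 4)) (aa′ (# 1) (# 3))
                          (leaf (aa′ (# 0) (# 4) ∷ ab (# 1) (# 3) ∷ ab (# 2) (# 2) ∷ ab (# 3) (# 0) ∷ []))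
                          (leaf (ab (# 0) (# 0) ∷ aa′ (# 1) (# 3) ∷ ab (# 2) (# 2) ∷ ab (# 4) (# 3) ∷ []))))))
                  (leaf (ab (# 0) (# 0) ∷ ab (# 1) (# 3) ∷ aa′ (# 2) (# 3) ∷ ab (# 4) (# 2) ∷ [])))))
            (node (ab (# 3) (# 0)) (aa′ (# 2) (# 3))
              (node (ab (# 0) (# 3)) (ab (# 0) (# 0))
                (node (aa′ (# 1) (# 2)) (ab (# 4) (# 2))
                  (node (aa′ (# 0) (# 3)) (ab (# 3) (# 2))
                    (leaf (aa′ (# 0) (# 3) ∷ aa′ (# 1) (# 2) ∷ ab (# 4) (# 0) ∷ []))
                    (leaf (ab (# 0) (# 1) ∷ aa′ (# 1) (# 2) ∷ ab (# 3) (# 2) ∷ ab (# 4) (# 0) ∷ [])))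
                  (node (aa′ (# 0) (# 2)) (ab (# 0) (# 2))
                    (leaf (aa′ (# 0) (# 2) ∷ ab (# 1) (# 3) ∷ ab (# 3) (# 0) ∷ ab (# 4) (# 2) ∷ []))
                    (node (ab (# 2) (# 0)) (ab (# 1) (# 2))
                      (node (ab (# 1) (# 1)) (aa′ (# 3) (# 4))
                        (node (aa′ (# 0) (# 4)) (aa′ (# 1) (# 3))
                          (node (aa′ (# 0) (# 3)) (ab (# 3) (# 2))
                            (leaf (aa′ (# 0) (# 3) ∷ ab (# 1) (# 3) ∷ ab (# 2) (# 0) ∷ ab (# 4) (# 2) ∷ []))
                            (leaf (aa′ (# 0) (# 4) ∷ ab (# 1) (# 3) ∷ ab (# 2) (# 0) ∷ ab (# 3) (# 2) ∷ [])))
                          (leaf (ab (# 0) (# 1) ∷ aa′ (# 1) (# 3) ∷ ab (# 2) (# 0) ∷ ab (# 4) (# 2) ∷ [])))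
                        (leaf (ab (# 0) (# 1) ∷ ab (# 1) (# 3) ∷ ab (# 2) (# 0) ∷ aa′ (# 3) (# 4) ∷ [])))
                      (node (aa′ (# 0) (# 1)) (ab (# 2) (# 2))
                        (node (ab (# 2) (# 1)) (ab (# 2) (# 3))
                          (leaf (aa′ (# 0) (# 1) ∷ ab (# 2) (# 1) ∷ ab (# 3) (# 0) ∷ ab (# 4) (# 2) ∷ []))
                          (leaf (aa′ (# 0) (# 1) ∷ ab (# 2) (# 3) ∷ ab (# 3) (# 0) ∷ ab (# 4) (# 2) ∷ [])))
                        (node (aa′ (# 0) (# 4)) (aa′ (# 1) (# 3))
                          (leaf (aa′ (# 0) (# 4) ∷ ab (# 1) (# 3) ∷ ab (# 2) (# 2) ∷ ab (# 3) (# 0) ∷ []))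
                          (leaf (ab (# 0) (# 1) ∷ aa′ (# 1) (# 3) ∷ ab (# 2) (# 2) ∷ ab (# 4) (# 0) ∷ [])))))))
                (node (aa′ (# 1) (# 2)) (ab (# 4) (# 2))
                  (node (aa′ (# 0) (# 3)) (ab (# 3) (# 2))
                    (leaf (aa′ (# 0) (# 3) ∷ aa′ (# 1) (# 2) ∷ ab (# 4) (# 0) ∷ []))
                    (leaf (ab (# 0) (# 1) ∷ aa′ (# 1) (# 2) ∷ ab (# 3) (# 2) ∷ ab (# 4) (# 0) ∷ [])))
                  (node (aa′ (# 0) (# 2)) (ab (# 0) (# 2))
                    (leaf (aa′ (# 0) (# 2) ∷ ab (# 1) (# 3) ∷ ab (# 3) (# 0) ∷ ab (# 4) (# 2) ∷ []))
                    (node (ab (# 2) (# 0)) (ab (# 1) (# 2))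
                      (node (ab (# 1) (# 1)) (aa′ (# 3) (# 4))
                        (node (aa′ (# 0) (# 4)) (aa′ (# 1) (# 3))
                          (node (aa′ (# 0) (# 3)) (ab (# 3) (# 2))
                            (leaf (aa′ (# 0) (# 3) ∷ ab (# 1) (# 3) ∷ ab (# 2) (# 0) ∷ ab (# 4) (# 2) ∷ []))
                            (leaf (aa′ (# 0) (# 4) ∷ ab (# 1) (# 3) ∷ ab (# 2) (# 0) ∷ ab (# 3) (# 2) ∷ [])))
                          (leaf (ab (# 0) (# 1) ∷ aa′ (# 1) (# 3) ∷ ab (# 2) (# 0) ∷ ab (# 4) (# 2) ∷ [])))
                        (leaf (ab (# 0) (# 1) ∷ ab (# 1) (# 3) ∷ ab (# 2) (# 0) ∷ aa′ (# 3) (# 4) ∷ [])))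
                      (node (aa′ (# 0) (# 1)) (ab (# 2) (# 2))
                        (node (ab (# 2) (# 1)) (ab (# 2) (# 3))
                          (leaf (aa′ (# 0) (# 1) ∷ ab (# 2) (# 1) ∷ ab (# 3) (# 0) ∷ ab (# 4) (# 2) ∷ []))
                          (leaf (aa′ (# 0) (# 1) ∷ ab (# 2) (# 3) ∷ ab (# 3) (# 0) ∷ ab (# 4) (# 2) ∷ [])))
                        (node (aa′ (# 0) (# 4)) (aa′ (# 1) (# 3))
                          (leaf (aa′ (# 0) (# 4) ∷ ab (# 1) (# 3) ∷ ab (# 2) (# 2) ∷ ab (# 3) (# 0) ∷ []))
                          (leaf (ab (# 0) (# 1) ∷ aa′ (# 1) (# 3) ∷ ab (# 2) (# 2) ∷ ab (# 4) (# 0) ∷ []))))))))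
              (leaf (ab (# 0) (# 1) ∷ ab (# 1) (# 3) ∷ aa′ (# 2) (# 3) ∷ ab (# 4) (# 0) ∷ [])))))
        (node (ab (# 3) (# 1)) (ab (# 1) (# 3))
          (node (aa′ (# 0) (# 2)) (ab (# 0) (# 2))
            (leaf (aa′ (# 0) (# 2) ∷ aa′ (# 1) (# 4) ∷ ab (# 3) (# 1) ∷ []))
            (node (aa′ (# 1) (# 2)) (ab (# 4) (# 2))
              (leaf (ab (# 0) (# 2) ∷ aa′ (# 1) (# 2) ∷ ab (# 3) (# 1) ∷ ab (# 4) (# 0) ∷ []))
              (node (ab (# 2) (# 0)) (ab (# 1) (# 2))
                (leaf (ab (# 0) (# 2) ∷ aa′ (# 1) (# 4) ∷ ab (# 2) (# 0) ∷ ab (# 3) (# 1) ∷ []))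
                (node (ab (# 3) (# 0)) (aa′ (# 2) (# 3))
                  (node (ab (# 2) (# 1)) (ab (# 2) (# 3))
                    (leaf (ab (# 0) (# 2) ∷ aa′ (# 1) (# 4) ∷ ab (# 2) (# 1) ∷ ab (# 3) (# 0) ∷ []))
                    (leaf (ab (# 0) (# 2) ∷ aa′ (# 1) (# 4) ∷ ab (# 2) (# 3) ∷ ab (# 3) (# 1) ∷ [])))
                  (leaf (ab (# 0) (# 2) ∷ aa′ (# 1) (# 4) ∷ aa′ (# 2) (# 3) ∷ []))))))
          (node (ab (# 4) (# 3)) (ab (# 0) (# 1))
            (node (ab (# 0) (# 3)) (ab (# 0) (# 0))
              (node (ab (# 3) (# 0)) (aa′ (# 2) (# 3))
                (node (aa′ (# 0) (# 1)) (ab (# 2) (# 2))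
                  (node (aa′ (# 0) (# 2)) (ab (# 0) (# 2))
                    (leaf (aa′ (# 0) (# 2) ∷ aa′ (# 1) (# 4) ∷ ab (# 3) (# 0) ∷ []))
                    (node (ab (# 2) (# 1)) (ab (# 2) (# 3))
                      (leaf (ab (# 0) (# 3) ∷ aa′ (# 1) (# 4) ∷ ab (# 2) (# 1) ∷ ab (# 3) (# 0) ∷ []))
                      (leaf (ab (# 0) (# 2) ∷ aa′ (# 1) (# 4) ∷ ab (# 2) (# 3) ∷ ab (# 3) (# 0) ∷ []))))
                  (leaf (ab (# 0) (# 3) ∷ aa′ (# 1) (# 4) ∷ ab (# 2) (# 2) ∷ ab (# 3) (# 0) ∷ [])))
                (leaf (ab (# 0) (# 3) ∷ aa′ (# 1) (# 4) ∷ aa′ (# 2) (# 3) ∷ [])))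
              (node (ab (# 3) (# 0)) (aa′ (# 2) (# 3))
                (node (aa′ (# 0) (# 2)) (ab (# 0) (# 2))
                  (leaf (aa′ (# 0) (# 2) ∷ aa′ (# 1) (# 4) ∷ ab (# 3) (# 0) ∷ []))
                  (node (ab (# 2) (# 1)) (ab (# 2) (# 3))
                    (leaf (ab (# 0) (# 2) ∷ aa′ (# 1) (# 4) ∷ ab (# 2) (# 1) ∷ ab (# 3) (# 0) ∷ []))
                    (leaf (ab (# 0) (# 2) ∷ aa′ (# 1) (# 4) ∷ ab (# 2) (# 3) ∷ ab (# 3) (# 0) ∷ []))))
                (leaf (ab (# 0) (# 0) ∷ aa′ (# 1) (# 4) ∷ aa′ (# 2) (# 3) ∷ []))))
            (node (ab (# 3) (# 0)) (aa′ (# 2) (# 3))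
              (node (aa′ (# 0) (# 1)) (ab (# 2) (# 2))
                (node (aa′ (# 0) (# 2)) (ab (# 0) (# 2))
                  (leaf (aa′ (# 0) (# 2) ∷ aa′ (# 1) (# 4) ∷ ab (# 3) (# 0) ∷ []))
                  (node (ab (# 2) (# 1)) (ab (# 2) (# 3))
                    (leaf (ab (# 0) (# 2) ∷ aa′ (# 1) (# 4) ∷ ab (# 2) (# 1) ∷ ab (# 3) (# 0) ∷ []))
                    (leaf (ab (# 0) (# 1) ∷ aa′ (# 1) (# 4) ∷ ab (# 2) (# 3) ∷ ab (# 3) (# 0) ∷ []))))
                (leaf (ab (# 0) (# 1) ∷ aa′ (# 1) (# 4) ∷ ab (# 2) (# 2) ∷ ab (# 3) (# 0) ∷ [])))
              (leaf (ab (# 0) (# 1) ∷ aa′ (# 1) (# 4) ∷ aa′ (# 2) (# 3) ∷ []))))))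
      (node (ab (# 1) (# 0)) (aa′ (# 1) (# 4))
        (node (aa′ (# 0) (# 3)) (ab (# 3) (# 2))
          (leaf (aa′ (# 0) (# 3) ∷ ab (# 1) (# 0) ∷ aa′ (# 2) (# 4) ∷ []))
          (node (ab (# 4) (# 3)) (ab (# 0) (# 1))
            (node (ab (# 0) (# 3)) (ab (# 0) (# 0))
              (leaf (ab (# 0) (# 3) ∷ ab (# 1) (# 0) ∷ aa′ (# 2) (# 4) ∷ ab (# 3) (# 2) ∷ []))
              (node (ab (# 3) (# 1)) (ab (# 1) (# 3))
                (node (aa′ (# 0) (# 2)) (ab (# 0) (# 2))
                  (leaf (aa′ (# 0) (# 2) ∷ ab (# 1) (# 0) ∷ ab (# 3) (# 2) ∷ ab (# 4) (# 3) ∷ []))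
                  (leaf (ab (# 0) (# 2) ∷ ab (# 1) (# 0) ∷ aa′ (# 2) (# 4) ∷ ab (# 3) (# 1) ∷ [])))
                (leaf (ab (# 0) (# 0) ∷ ab (# 1) (# 3) ∷ aa′ (# 2) (# 4) ∷ ab (# 3) (# 2) ∷ []))))
            (leaf (ab (# 0) (# 1) ∷ ab (# 1) (# 0) ∷ aa′ (# 2) (# 4) ∷ ab (# 3) (# 2) ∷ []))))
        (node (ab (# 3) (# 1)) (ab (# 1) (# 3))
          (node (aa′ (# 0) (# 1)) (ab (# 2) (# 2))
            (leaf (aa′ (# 0) (# 1) ∷ aa′ (# 2) (# 4) ∷ ab (# 3) (# 1) ∷ []))
            (node (ab (# 0) (# 3)) (ab (# 0) (# 0))
              (leaf (ab (# 0) (# 3) ∷ aa′ (# 1) (# 4) ∷ ab (# 2) (# 2) ∷ ab (# 3) (# 1) ∷ []))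
              (leaf (ab (# 0) (# 0) ∷ aa′ (# 1) (# 4) ∷ ab (# 2) (# 2) ∷ ab (# 3) (# 1) ∷ []))))
          (node (aa′ (# 0) (# 3)) (ab (# 3) (# 2))
            (leaf (aa′ (# 0) (# 3) ∷ ab (# 1) (# 3) ∷ aa′ (# 2) (# 4) ∷ []))
            (node (ab (# 4) (# 3)) (ab (# 0) (# 1))
              (node (ab (# 0) (# 3)) (ab (# 0) (# 0))
                (node (ab (# 2) (# 0)) (ab (# 1) (# 2))
                  (leaf (ab (# 0) (# 3) ∷ aa′ (# 1) (# 4) ∷ ab (# 2) (# 0) ∷ ab (# 3) (# 2) ∷ []))
                  (node (ab (# 3) (# 0)) (aa′ (# 2) (# 3))
                    (leaf (ab (# 0) (# 3) ∷ ab (# 1) (# 2) ∷ aa′ (# 2) (# 4) ∷ ab (# 3) (# 0) ∷ []))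
                    (leaf (ab (# 0) (# 3) ∷ aa′ (# 1) (# 4) ∷ aa′ (# 2) (# 3) ∷ []))))
                (leaf (ab (# 0) (# 0) ∷ ab (# 1) (# 3) ∷ aa′ (# 2) (# 4) ∷ ab (# 3) (# 2) ∷ [])))
              (leaf (ab (# 0) (# 1) ∷ ab (# 1) (# 3) ∷ aa′ (# 2) (# 4) ∷ ab (# 3) (# 2) ∷ []))))))

pairing60 : WinningPairing 6 0
pairing60 = fromCertificate tree
  where
  open Certificate
    ( (aa′ (# 1) (# 2) , aa′ (# 0) (# 2))
    ∷ (aa′ (# 4) (# 5) , aa′ (# 2) (# 4))
    ∷ (aa′ (# 1) (# 5) , aa′ (# 0) (# 5))
    ∷ (aa′ (# 3) (# 5) , aa′ (# 2) (# 3))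
    ∷ (aa′ (# 0) (# 1) , aa′ (# 3) (# 4))
    ∷ (aa′ (# 0) (# 3) , aa′ (# 0) (# 4))
    ∷ (aa′ (# 1) (# 4) , aa′ (# 1) (# 3))
    ∷ [])
  tree : CaseTree
  tree =
    node (aa′ (# 1) (# 2)) (aa′ (# 0) (# 2))
      (node (aa′ (# 4) (# 5)) (aa′ (# 2) (# 4))
        (node (aa′ (# 0) (# 3)) (aa′ (# 0) (# 4))
          (leaf (aa′ (# 0) (# 3) ∷ aa′ (# 1) (# 2) ∷ aa′ (# 4) (# 5) ∷ []))
          (node (aa′ (# 3) (# 5)) (aa′ (# 2) (# 3))
            (leaf (aa′ (# 0) (# 4) ∷ aa′ (# 1) (# 2) ∷ aa′ (# 3) (# 5) ∷ []))
            (node (aa′ (# 1) (# 5)) (aa′ (# 0) (# 5))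
              (leaf (aa′ (# 0) (# 4) ∷ aa′ (# 1) (# 5) ∷ aa′ (# 2) (# 3) ∷ []))
              (node (aa′ (# 0) (# 1)) (aa′ (# 3) (# 4))
                (leaf (aa′ (# 0) (# 1) ∷ aa′ (# 2) (# 3) ∷ aa′ (# 4) (# 5) ∷ []))
                (leaf (aa′ (# 0) (# 5) ∷ aa′ (# 1) (# 2) ∷ aa′ (# 3) (# 4) ∷ []))))))
        (node (aa′ (# 1) (# 5)) (aa′ (# 0) (# 5))
          (node (aa′ (# 0) (# 3)) (aa′ (# 0) (# 4))
            (leaf (aa′ (# 0) (# 3) ∷ aa′ (# 1) (# 5) ∷ aa′ (# 2) (# 4) ∷ []))
            (node (aa′ (# 3) (# 5)) (aa′ (# 2) (# 3))
              (leaf (aa′ (# 0) (# 4) ∷ aa′ (# 1) (# 2) ∷ aa′ (# 3) (# 5) ∷ []))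
              (leaf (aa′ (# 0) (# 4) ∷ aa′ (# 1) (# 5) ∷ aa′ (# 2) (# 3) ∷ []))))
          (node (aa′ (# 0) (# 1)) (aa′ (# 3) (# 4))
            (node (aa′ (# 3) (# 5)) (aa′ (# 2) (# 3))
              (leaf (aa′ (# 0) (# 1) ∷ aa′ (# 2) (# 4) ∷ aa′ (# 3) (# 5) ∷ []))
              (node (aa′ (# 1) (# 4)) (aa′ (# 1) (# 3))
                (leaf (aa′ (# 0) (# 5) ∷ aa′ (# 1) (# 4) ∷ aa′ (# 2) (# 3) ∷ []))
                (leaf (aa′ (# 0) (# 5) ∷ aa′ (# 1) (# 3) ∷ aa′ (# 2) (# 4) ∷ []))))
            (leaf (aa′ (# 0) (# 5) ∷ aa′ (# 1) (# 2) ∷ aa′ (# 3) (# 4) ∷ [])))))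
      (node (aa′ (# 4) (# 5)) (aa′ (# 2) (# 4))
        (node (aa′ (# 1) (# 4)) (aa′ (# 1) (# 3))
          (node (aa′ (# 3) (# 5)) (aa′ (# 2) (# 3))
            (leaf (aa′ (# 0) (# 2) ∷ aa′ (# 1) (# 4) ∷ aa′ (# 3) (# 5) ∷ []))
            (node (aa′ (# 1) (# 5)) (aa′ (# 0) (# 5))
              (node (aa′ (# 0) (# 1)) (aa′ (# 3) (# 4))
                (leaf (aa′ (# 0) (# 1) ∷ aa′ (# 2) (# 3) ∷ aa′ (# 4) (# 5) ∷ []))
                (leaf (aa′ (# 0) (# 2) ∷ aa′ (# 1) (# 5) ∷ aa′ (# 3) (# 4) ∷ [])))
              (leaf (aa′ (# 0) (# 5) ∷ aa′ (# 1) (# 4) ∷ aa′ (# 2) (# 3) ∷ []))))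
          (leaf (aa′ (# 0) (# 2) ∷ aa′ (# 1) (# 3) ∷ aa′ (# 4) (# 5) ∷ [])))
        (node (aa′ (# 1) (# 5)) (aa′ (# 0) (# 5))
          (node (aa′ (# 0) (# 1)) (aa′ (# 3) (# 4))
            (node (aa′ (# 3) (# 5)) (aa′ (# 2) (# 3))
              (leaf (aa′ (# 0) (# 1) ∷ aa′ (# 2) (# 4) ∷ aa′ (# 3) (# 5) ∷ []))
              (node (aa′ (# 0) (# 3)) (aa′ (# 0) (# 4))
                (leaf (aa′ (# 0) (# 3) ∷ aa′ (# 1) (# 5) ∷ aa′ (# 2) (# 4) ∷ []))
                (leaf (aa′ (# 0) (# 4) ∷ aa′ (# 1) (# 5) ∷ aa′ (# 2) (# 3) ∷ []))))
            (leaf (aa′ (# 0) (# 2) ∷ aa′ (# 1) (# 5) ∷ aa′ (# 3) (# 4) ∷ [])))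
          (node (aa′ (# 1) (# 4)) (aa′ (# 1) (# 3))
            (node (aa′ (# 3) (# 5)) (aa′ (# 2) (# 3))
              (leaf (aa′ (# 0) (# 2) ∷ aa′ (# 1) (# 4) ∷ aa′ (# 3) (# 5) ∷ []))
              (leaf (aa′ (# 0) (# 5) ∷ aa′ (# 1) (# 4) ∷ aa′ (# 2) (# 3) ∷ [])))
            (leaf (aa′ (# 0) (# 5) ∷ aa′ (# 1) (# 3) ∷ aa′ (# 2) (# 4) ∷ [])))))

winningPairing₄ : ∀ a → WinningPairing a 4
winningPairing₄ 0 = emptyPairing 4
winningPairing₄ 1 = extendB (s≤s (s≤s z≤n)) pairing12
winningPairing₄ 2 = extendB (s≤s (s≤s (s≤s z≤n))) pairing23
winningPairing₄ 3 = extendB (s≤s (s≤s (s≤s z≤n))) pairing33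
winningPairing₄ 4 = pairing44
winningPairing₄ 5 = pairing54
winningPairing₄ (suc (suc (suc (suc (suc (suc a)))))) = combineA 6 a 4 pairing60 (winningPairing₄ a)

lemma6p6 : (a b : ℕ) → 1 ≤ a → 1 ≤ b →
           (4 ≤ b ⊎ ((a ≡ 2 ⊎ a ≡ 3) × 3 ≤ b) ⊎ (a ≡ 1 × 2 ≤ b)) →
           MakerWins a b
lemma6p6 a b _ _ (inj₁ 4≤b)                         = pairingStrategy (extendB 4≤b (winningPairing₄ a))
lemma6p6 .2 b _ _ (inj₂ (inj₁ (inj₁ refl , 3≤b))) = pairingStrategy (extendB 3≤b pairing23)
lemma6p6 .3 b _ _ (inj₂ (inj₁ (inj₂ refl , 3≤b))) = pairingStrategy (extendB 3≤b pairing33)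
lemma6p6 .1 b _ _ (inj₂ (inj₂ (refl , 2≤b)))      = pairingStrategy (extendB 2≤b pairing12)
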